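{- Let $\Pi$ be a linear $m$-scheme on $S\subseteq V$. Then: (1) For $k\in[m]$ and $T\in\mathcal{B}(\mathcal{S}_{\Pi,k})$, we have $T\cap S\in\mathcal{B}(\Pi^{(1)})$. (2) If $T\in\mathcal{B}(\mathcal{S}_{\Pi,k})$ and $T'\in\mathcal{B}(\mathcal{S}_{\Pi,k'})$ with $k,k'\in\mathbb{N}^+$, $k+k'\le m$, then $T\cap T'\in\mathcal{B}(\mathcal{S}_{\Pi,k})$ and $T\setminus T'\in\mathcal{B}(\mathcal{S}_{\Pi,k})$.
   Context: $V$ is a finite-dimensional vector space over a finite field $\mathbb{F}$. $\mathcal{M}_{k,k'}$ is the set of maps $V^k\to V^{k'}$, $(x_1,\dots,x_k)\mapsto(\sum_i c_{i,1}x_i,\dots,\sum_i c_{i,k'}x_i)$, $c_{i,j}\in\mathbb{F}$. A linear $m$-scheme on $S$ is $\Pi=\{\Pi^{(1)},\dots,\Pi^{(m)}\}$ with $\Pi^{(k)}$ a partition of $S^k$ such that for all $k,k'\in[m]$, $B\in\Pi^{(k)}$, $B'\in\Pi^{(k')}$, $\tau\in\mathcal{M}_{k,k'}$: (P1) $\tau(B)=B'$ or $\tau(B)\cap B'=\emptyset$; (P2) $\#\{x\in B:\tau(x)=y\}$ is constant for $y\in B'$. $\mathcal{S}_{\Pi,k}=\{\tau(B):B\in\Pi^{(k)},\tau\in\mathcal{M}_{k,1}\}$ (a set of subsets of $V$). For a set $P$ of subsets, $\mathcal{B}(P)$ is the set of all unions of members of $P$ (subsets of $V$ for $P=\mathcal{S}_{\Pi,k}$,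 subsets of $S$ for $P=\Pi^{(1)}$). -}

module Defs where

open import Level using (0ℓ)
open import Data.Nat using (ℕ; zero; suc)
open import Data.Bool using (Bool; true; false; _∧_)
open import Data.Fin using (Fin)
open import Data.Vec using (Vec; []; _∷_; zipWith; tabulate; foldr′; replicate; lookup)
import Data.Vec as Vec
open import Data.Vec.Properties using (≡-dec)
open import Data.List using (List; [_]; concatMap; filter; length)
import Data.List as List
open import Data.List.Membership.Propositional using (_∈_)
open import Data.List.Relation.Unary.Unique.Propositional using (Unique)
open import Data.Product using (Σ; ∃; _×_; _,_)
open import Data.Empty using (⊥)
import Data.Sum
import Data.Nat
open import Relation.Nullary using (¬_)
open import Relation.Nullary.Decidable using (⌊_⌋)
open import Relation.Unary using (Pred)
open import Relation.Binary.Definitions using (DecidableEquality)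
open import Relation.Binary.PropositionalEquality using (_≡_; _≢_)
open import Algebra.Structures using (IsCommutativeRing)

record FiniteField : Set₁ where
  infixl 7 _*_
  infixl 6 _+_
  field
    Carrier  : Set
    _+_ _*_  : Carrier → Carrier → Carrier
    -_       : Carrier → Carrier
    0# 1#    : Carrier
    isCommutativeRing : IsCommutativeRing _≡_ _+_ _*_ -_ 0# 1#
    0≢1      : 0# ≢ 1#
    inverse  : ∀ x → x ≢ 0# → Σ Carrier (λ y → x * y ≡ 1#)
    _≟_      : DecidableEquality Carrier
    elems    : List Carrier
    elems-unique   : Unique elems
    elems-complete : ∀ x → x ∈ elems

vecs : {A : Set} → List A → (n : ℕ) → List (Vec A n)
vecs xs zero    = [ [] ]
vecs xs (suc n) = concatMap (λ x → List.map (x ∷_) (vecs xs n)) xs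

BSub : Set → Set
BSub X = X → Bool

_∈ᵇ_ : {X : Set} → X → BSub X → Set
x ∈ᵇ B = B x ≡ true

module _ (𝔽 : FiniteField) (n : ℕ) where
  open FiniteField 𝔽

  V : Set
  V = Vec Carrier n

  vzero : V
  vzero = replicate n 0#

  _⊕_ : V → V → V
  _⊕_ = zipWith _+_

  _·_ : Carrier → V → V
  c · v = Vec.map (c *_) v

  allTuples : (k : ℕ) → List (Vec V k)
  allTuples k = vecs (vecs elems n) k

  _≟V*_ : {k : ℕ} → DecidableEquality (Vec V k)
  _≟V*_ = ≡-dec (≡-dec _≟_)

  -- Coefficient data c_{i,j} (i ∈ [k], j ∈ [k']) of a map in M_{k,k'}
  Coeffs : ℕ → ℕ → Set
  Coeffs k k' = Vec (Vec Carrier k') k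

  applyM : {k k' : ℕ} → Coeffs k k' → Vec V k → Vec V k'
  applyM {k} {k'} c x =
    tabulate (λ j → foldr′ _⊕_ vzero (zipWith (λ ci xi → lookup ci j · xi) c x))

  image : {k k' : ℕ} → Coeffs k k' → BSub (Vec V k) → Pred (Vec V k') 0ℓ
  image c B y = ∃ λ x → x ∈ᵇ B × applyM c x ≡ y

  fiberCount : {k k' : ℕ} → Coeffs k k' → BSub (Vec V k) → Vec V k' → ℕ
  fiberCount {k} c B y =
    length (filter (λ x → (B x ∧ ⌊ applyM c x ≟V* y ⌋) ≟B true) (allTuples k))
    where
      open import Data.Bool.Properties using () renaming (_≟_ to _≟B_)

  _^_ : Pred V 0ℓ → (k : ℕ) → Pred (Vec V k) 0ℓ
  (S ^ k) x = ∀ i → S (lookup x i)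

  record Partition (S : Pred V 0ℓ) (k : ℕ) : Set where
    field
      size      : ℕ
      block     : Fin size → BSub (Vec V k)
      nonempty  : ∀ i → ∃ λ x → x ∈ᵇ block i
      ⊆S^k      : ∀ i x → x ∈ᵇ block i → (S ^ k) x
      covers    : ∀ x → (S ^ k) x → ∃ λ i → x ∈ᵇ block i
      disjoint  : ∀ i j x → x ∈ᵇ block i → x ∈ᵇ block j → i ≡ j

  -- A linear m-scheme on S: a partition Π^(k) of S^k for each k (only
  -- k ∈ [m] = {1,…,m} is constrained / used) satisfying (P1),(P2)
  -- for all k, k' ∈ [m].
  record IsLinearScheme (m : ℕ) (S : Pred V 0ℓ)
                        (Π : (k : ℕ) → Partition S k) : Set where
    open Partition
    field
      P1 : ∀ k k' → 1 Data.Nat.≤ k → k Data.Nat.≤ m → 1 Data.Nat.≤ k' → k' Data.Nat.≤ m →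
           (i : Fin (size (Π k))) (i' : Fin (size (Π k'))) (c : Coeffs k k') →
           (∀ y → (image c (block (Π k) i) y → y ∈ᵇ block (Π k') i')
                × (y ∈ᵇ block (Π k') i' → image c (block (Π k) i) y))
           Data.Sum.⊎
           (∀ y → image c (block (Π k) i) y → y ∈ᵇ block (Π k') i' → ⊥)
      P2 : ∀ k k' → 1 Data.Nat.≤ k → k Data.Nat.≤ m → 1 Data.Nat.≤ k' → k' Data.Nat.≤ m →
           (i : Fin (size (Π k))) (i' : Fin (size (Π k'))) (c : Coeffs k k') →
           ∀ y y' → y ∈ᵇ block (Π k') i' → y' ∈ᵇ block (Π k') i' →
           fiberCount c (block (Π k) i) y ≡ fiberCount c (block (Π k) i) y'

  -- T ∈ B(S_{Π,k}): T is a union of sets τ(B), B ∈ Π^(k), τ ∈ M_{k,1};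
  -- the sub-collection is given by a (Boolean) selector Q on the finitely
-- many pairs (B, τ).
  InUnionsS : {S : Pred V 0ℓ} → (Π : (k : ℕ) → Partition S k) → (k : ℕ) →
              Pred V 0ℓ → Set
  InUnionsS Π k T =
    ∃ λ (Q : BSub (Fin (Partition.size (Π k)) × Coeffs k 1)) →
      ∀ y → (T y → ∃ λ i → ∃ λ c → (i , c) ∈ᵇ Q × image c (Partition.block (Π k) i) (y ∷ []))
          × ((∃ λ i → ∃ λ c → (i , c) ∈ᵇ Q × image c (Partition.block (Π k) i) (y ∷ [])) → T y)

  -- U ∈ B(Π^(1)) for U ⊆ S (identifying S^1 with S via y ↦ (y))
  InUnionsΠ1 : {S : Pred V 0ℓ} → (Π : (k : ℕ) → Partition S k) →
               Pred V 0ℓ → Set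
  InUnionsΠ1 Π U =
    ∃ λ (Q : BSub (Fin (Partition.size (Π 1)))) →
      ∀ y → (U y → ∃ λ i → i ∈ᵇ Q × (y ∷ []) ∈ᵇ Partition.block (Π 1) i)
          × ((∃ λ i → i ∈ᵇ Q × (y ∷ []) ∈ᵇ Partition.block (Π 1) i) → U y)

{-# OPTIONS --safe #-}

-- A piece τ(B) (B ∈ Π^(k), τ ∈ M_{k,1}) that meets a block of Π^(1) contains it, by (P1) for τ;
-- so a union of pieces meets S in a union of Π^(1)-blocks.
-- For (2), let τ(x) = τ'(x') with x ∈ B ∈ Π^(k), x' ∈ B' ∈ Π^(k'), and let C ∈ Π^(k+k') contain
-- x ++ x'. By (P1) the two coordinate projections map C onto B and B'. The linear functional
-- D(w) = τ(w_left) − τ'(w_right) vanishes at x ++ x', hence on all of C: if D ≠ 0, the linear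
-- retraction of V^(k+k') onto Ker D fixes x ++ x', so by (P1) it maps C onto C. Thus τ(B) ⊆ τ'(B'),
-- so every piece of level k lies inside or outside a union T' of pieces of level k', and T ∩ T',
-- T ∖ T' are unions of pieces of level k. Finiteness makes membership in such unions decidable,
-- which is what selecting these pieces requires.

module Submission where

open import Defs
open import Level using (0ℓ)
open import Data.Nat using (ℕ; _≤_)
import Data.Nat as ℕ
open import Data.Product using (_×_; ∃; ∃₂; _,_; proj₁; proj₂)
open import Relation.Unary using (Pred; Decidable; _⊆_; _≐_; _∩_; _∖_; ∁)

open import Algebra.Bundles using (CommutativeRing)
import Algebra.Properties.Group as GroupProperties
import Algebra.Properties.Ring as RingProperties
import Algebra.Properties.Semiring.Sum as SemiringSum
open import Data.Bool using (true)
import Data.Bool as Bool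
open import Data.Fin using (Fin; zero; suc; _↑ˡ_; _↑ʳ_; splitAt)
open import Data.Fin.Properties using (any?; all?; ¬∀⟶∃¬)
open import Data.List using (List)
import Data.List as List
open import Data.List.Membership.Propositional using (_∈_)
open import Data.List.Membership.Propositional.Properties using (∈-concatMap⁺; ∈-map⁺)
import Data.List.Relation.Unary.Any as Any
open import Data.Empty using (⊥-elim)
open import Data.Nat.Properties using (≤-refl; ≤-trans; m≤m+n; m≤n+m)
open import Data.Sum using (inj₁; inj₂; [_,_]; [_,_]′)
open import Data.Vec using (Vec; []; _∷_; lookup; tabulate; _++_; head; zipWith; foldr′)
import Data.Vec as Vec
open import Data.Vec.Properties
  using (lookup∘tabulate; tabulate∘lookup; tabulate-cong; lookup-zipWith; lookup-map; lookup-replicate;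
         lookup-++ˡ; lookup-++ʳ; lookup-splitAt)
open import Relation.Binary using (Rel)
open import Relation.Binary.Definitions using (_Respects_; Symmetric)
open import Relation.Binary.PropositionalEquality using (_≡_; refl; sym; trans; cong; cong₂; subst; module ≡-Reasoning)
open import Function using (_∘_)
open import Relation.Nullary using (Dec; yes; no; ¬?; does)
open import Relation.Nullary.Decidable using (dec-true; map′; _×-dec_)

private
  variable
    A : Set
    a b k k' : ℕ

entry : Vec (Vec A b) a → Fin a → Fin b → A
entry x i j = lookup (lookup x i) j

lookup-ext : {u v : Vec A k} → (∀ i → lookup u i ≡ lookup v i) → u ≡ v
lookup-ext {u = u} {v} u≗v = trans (sym (tabulate∘lookup u)) (trans (tabulate-cong u≗v) (tabulate∘lookup v))

entry-ext : {u v : Vec (Vec A b) a} → (∀ i j → entry u i j ≡ entry v i j) → u ≡ v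
entry-ext u≗v = lookup-ext (λ i → lookup-ext (u≗v i))

vec1-η : (v : Vec A 1) → v ≡ head v ∷ []
vec1-η (x ∷ []) = refl

does⇒ : {P : Set} (p? : Dec P) → does p? ≡ true → P
does⇒ (yes p) _ = p

∃?-enumerable : {P : A → Set} (xs : List A) → (∀ x → x ∈ xs) → Decidable P → Dec (∃ P)
∃?-enumerable xs complete P? =
  map′ Any.satisfied (λ (x , px) → Any.map (λ { refl → px }) (complete x)) (Any.any? P? xs)

∁-respects : {P : Pred A 0ℓ} {R : Rel A 0ℓ} → Symmetric R → P Respects R → ∁ P Respects R
∁-respects sym-R P-resp y~z ¬Py Pz = ¬Py (P-resp (sym-R y~z) Pz)

vecs-complete : (xs : List A) → (∀ x → x ∈ xs) → (v : Vec A k) → v ∈ vecs xs k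
vecs-complete xs complete [] = Any.here refl
vecs-complete {k = ℕ.suc k} xs complete (x ∷ v) =
  ∈-concatMap⁺ (λ y → List.map (y ∷_) (vecs xs k))
    (Any.map (λ { refl → ∈-map⁺ (x ∷_) (vecs-complete xs complete v) }) (complete x))

module CommutativeRingSums {c ℓ} (R : CommutativeRing c ℓ) where
  open CommutativeRing R
    using (Carrier; _≈_; _+_; _*_; -_; 0#; 1#; setoid; +-cong; +-congˡ; +-identityˡ; +-identityʳ; +-assoc;
           zeroˡ; *-identityˡ; *-comm; semiring)
    renaming (sym to ≈-sym; trans to ≈-trans)
  open SemiringSum semiring public using (sum; sum-cong-≋; sum-cong-≗; ∑-distrib-+; *-distribˡ-sum; *-distribʳ-sum)
  open RingProperties (CommutativeRing.ring R) using (-1*x≈-x)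
  open import Relation.Binary.Reasoning.Setoid setoid

  δ : Fin k → Fin k → Carrier
  δ zero    zero    = 1#
  δ zero    (suc _) = 0#
  δ (suc _) zero    = 0#
  δ (suc i) (suc j) = δ i j

  sum-0* : (f : Fin k → Carrier) → sum (λ i → 0# * f i) ≈ 0#
  sum-0* f = ≈-trans (≈-sym (*-distribˡ-sum 0# f)) (zeroˡ (sum f))

  sum-δ : (j : Fin k) (f : Fin k → Carrier) → sum (λ i → δ i j * f i) ≈ f j
  sum-δ zero f = begin
    1# * f zero + sum (λ i → 0# * f (suc i)) ≈⟨ +-cong (*-identityˡ _) (sum-0* (f ∘ suc)) ⟩
    f zero + 0#                              ≈⟨ +-identityʳ _ ⟩
    f zero                                   ∎
  sum-δ (suc j) f = begin
    0# * f zero + sum (λ i → δ i j * f (suc i)) ≈⟨ +-cong (zeroˡ _) (sum-δ j (f ∘ suc)) ⟩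
    0# + f (suc j)                              ≈⟨ +-identityˡ _ ⟩
    f (suc j)                                   ∎

  sum-*δ : (j : Fin k) (f : Fin k → Carrier) → sum (λ i → f i * δ i j) ≈ f j
  sum-*δ j f = ≈-trans (sum-cong-≋ (λ i → *-comm (f i) (δ i j))) (sum-δ j f)

  sum-++ : ∀ k {k'} (f : Fin (k ℕ.+ k') → Carrier) →
           sum f ≈ sum (λ i → f (i ↑ˡ k')) + sum (λ i → f (k ↑ʳ i))
  sum-++ ℕ.zero    f = ≈-sym (+-identityˡ _)
  sum-++ (ℕ.suc k) f = ≈-trans (+-congˡ (sum-++ k (f ∘ suc))) (≈-sym (+-assoc _ _ _))

  sum-neg : (f : Fin k → Carrier) → sum (λ i → - f i) ≈ - sum f
  sum-neg f = begin
    sum (λ i → - f i)      ≈⟨ sum-cong-≋ (λ i → -1*x≈-x (f i)) ⟨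
    sum (λ i → - 1# * f i) ≈⟨ *-distribˡ-sum (- 1#) f ⟨
    - 1# * sum f           ≈⟨ -1*x≈-x _ ⟩
    - sum f                ∎

module LinearAlgebra (𝔽 : FiniteField) (n : ℕ) where
  open FiniteField 𝔽 using (Carrier; isCommutativeRing; elems; elems-complete)

  ring : CommutativeRing 0ℓ 0ℓ
  ring = record { isCommutativeRing = isCommutativeRing }

  open CommutativeRingSums ring
  open CommutativeRing ring
    using (_+_; _*_; -_; 0#; 1#; +-identityʳ; -‿inverseʳ; zeroʳ; *-assoc; distribˡ; distribʳ; +-group)
  open RingProperties (CommutativeRing.ring ring) using (-1*x≈-x; -‿distribˡ-*; -‿distribʳ-*)
  open GroupProperties +-group using (x∙y⁻¹≈ε⇒x≈y)
  open ≡-Reasoning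

  Vⁿ : Set
  Vⁿ = V 𝔽 n

  ⟦_⟧ : Coeffs 𝔽 n k k' → Vec Vⁿ k → Vec Vⁿ k'
  ⟦_⟧ = applyM 𝔽 n

  ∃?-matrix : {P : Vec (Vec Carrier a) b → Set} → Decidable P → Dec (∃ P)
  ∃?-matrix = ∃?-enumerable _ (vecs-complete _ (vecs-complete elems elems-complete))

  image? : (c : Coeffs 𝔽 n k k') (B : BSub (Vec Vⁿ k)) → Decidable (image 𝔽 n c B)
  image? c B y = ∃?-matrix (λ x → (B x Bool.≟ true) ×-dec (_≟V*_ 𝔽 n (⟦ c ⟧ x) y))

  applyM-entry : (c : Coeffs 𝔽 n k k') (x : Vec Vⁿ k) (j : Fin k') (r : Fin n) →
                 entry (⟦ c ⟧ x) j r ≡ sum (λ i → entry c i j * entry x i r)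
  applyM-entry {k' = k'} c x j r = trans (cong (λ v → lookup v r) (lookup∘tabulate _ j)) (fold-entry c x)
    where
      fold-entry : (c : Coeffs 𝔽 n k k') (x : Vec Vⁿ k) →
        lookup (foldr′ (_⊕_ 𝔽 n) (vzero 𝔽 n) (zipWith (λ ci xi → _·_ 𝔽 n (lookup ci j) xi) c x)) r
          ≡ sum (λ i → entry c i j * entry x i r)
      fold-entry [] [] = lookup-replicate r 0#
      fold-entry (ci ∷ c) (xi ∷ x) =
        trans (lookup-zipWith _+_ r (_·_ 𝔽 n (lookup ci j) xi) _)
              (cong₂ _+_ (lookup-map r (lookup ci j *_) xi) (fold-entry c x))

  fromEntries : (Fin a → Fin b → Carrier) → Coeffs 𝔽 n a b
  fromEntries f = tabulate (λ i → tabulate (f i))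

  entry-fromEntries : (f : Fin a → Fin b → Carrier) (i : Fin a) (j : Fin b) → entry (fromEntries f) i j ≡ f i j
  entry-fromEntries f i j = trans (cong (λ row → lookup row j) (lookup∘tabulate _ i)) (lookup∘tabulate (f i) j)

  applyM-fromEntries : (f : Fin a → Fin b → Carrier) (x : Vec Vⁿ a) (j : Fin b) (r : Fin n) →
                       entry (⟦ fromEntries f ⟧ x) j r ≡ sum (λ i → f i j * entry x i r)
  applyM-fromEntries f x j r = trans (applyM-entry (fromEntries f) x j r)
    (sum-cong-≗ (λ i → cong (_* entry x i r) (entry-fromEntries f i j)))

  Ker : Coeffs 𝔽 n k 1 → Pred (Vec Vⁿ k) 0ℓ
  Ker D z = ∀ r → entry (⟦ D ⟧ z) zero r ≡ 0#

  Ker-null : (D : Coeffs 𝔽 n k 1) → (∀ l → entry D l zero ≡ 0#) → (z : Vec Vⁿ k) → Ker D z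
  Ker-null D D≡0 z r = begin
    entry (⟦ D ⟧ z) zero r                  ≡⟨ applyM-entry D z zero r ⟩
    sum (λ l → entry D l zero * entry z l r) ≡⟨ sum-cong-≗ (λ l → cong (_* entry z l r) (D≡0 l)) ⟩
    sum (λ l → 0# * entry z l r)             ≡⟨ sum-0* (λ l → entry z l r) ⟩
    0#                                       ∎

  module Retraction (D : Coeffs 𝔽 n k 1) (j₀ : Fin k) {e : Carrier} (inv : entry D j₀ zero * e ≡ 1#) where
    d : Fin k → Carrier
    d l = entry D l zero

    -- With e = (d j₀)⁻¹, the map z ↦ z − e D(z) e_{j₀}.
    retraction : Coeffs 𝔽 n k k
    retraction = fromEntries (λ l j → δ l j + δ j j₀ * - e * d l)

    retraction-entry : (z : Vec Vⁿ k) (j : Fin k) (r : Fin n) →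
                       entry (⟦ retraction ⟧ z) j r ≡ entry z j r + δ j j₀ * - e * entry (⟦ D ⟧ z) zero r
    retraction-entry z j r = begin
      entry (⟦ retraction ⟧ z) j r
        ≡⟨ applyM-fromEntries _ z j r ⟩
      sum (λ l → (δ l j + c * d l) * entry z l r)
        ≡⟨ sum-cong-≗ (λ l → trans (distribʳ _ _ _) (cong (δ l j * entry z l r +_) (*-assoc c (d l) _))) ⟩
      sum (λ l → δ l j * entry z l r + c * (d l * entry z l r))
        ≡⟨ ∑-distrib-+ (λ l → δ l j * entry z l r) (λ l → c * (d l * entry z l r)) ⟩
      sum (λ l → δ l j * entry z l r) + sum (λ l → c * (d l * entry z l r))
        ≡⟨ cong₂ _+_ (sum-δ j (λ l → entry z l r)) (sym (*-distribˡ-sum c (λ l → d l * entry z l r))) ⟩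
      entry z j r + c * sum (λ l → d l * entry z l r)
        ≡⟨ cong (λ t → entry z j r + c * t) (sym (applyM-entry D z zero r)) ⟩
      entry z j r + c * entry (⟦ D ⟧ z) zero r
        ∎
      where
        c = δ j j₀ * - e

    retraction-Ker : (z : Vec Vⁿ k) → Ker D (⟦ retraction ⟧ z)
    retraction-Ker z r = begin
      entry (⟦ D ⟧ (⟦ retraction ⟧ z)) zero r
        ≡⟨ applyM-entry D _ zero r ⟩
      sum (λ j → d j * entry (⟦ retraction ⟧ z) j r)
        ≡⟨ sum-cong-≗ (λ j → trans (cong (d j *_) (retraction-entry z j r)) (distribˡ _ _ _)) ⟩
      sum (λ j → d j * entry z j r + d j * (δ j j₀ * - e * t))
        ≡⟨ ∑-distrib-+ (λ j → d j * entry z j r) (λ j → d j * (δ j j₀ * - e * t)) ⟩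
      sum (λ j → d j * entry z j r) + sum (λ j → d j * (δ j j₀ * - e * t))
        ≡⟨ cong₂ _+_ (sym (applyM-entry D z zero r))
                     (sum-cong-≗ (λ j → trans (cong (d j *_) (*-assoc _ _ _)) (sym (*-assoc _ _ _)))) ⟩
      t + sum (λ j → d j * δ j j₀ * (- e * t))
        ≡⟨ cong (t +_) (trans (sym (*-distribʳ-sum (- e * t) (λ j → d j * δ j j₀))) (cong (_* (- e * t)) (sum-*δ j₀ d))) ⟩
      t + d j₀ * (- e * t)
        ≡⟨ cong (t +_) (trans (sym (*-assoc _ _ _)) (cong (_* t) (sym (-‿distribʳ-* _ _)))) ⟩
      t + - (d j₀ * e) * t
        ≡⟨ cong (λ u → t + - u * t) inv ⟩
      t + - 1# * t
        ≡⟨ cong (t +_) (-1*x≈-x t) ⟩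
      t + - t
        ≡⟨ -‿inverseʳ t ⟩
      0#
        ∎
      where
        t = entry (⟦ D ⟧ z) zero r

    retraction-fixes-Ker : (z : Vec Vⁿ k) → Ker D z → ⟦ retraction ⟧ z ≡ z
    retraction-fixes-Ker z z∈Ker = entry-ext λ j r → begin
      entry (⟦ retraction ⟧ z) j r                        ≡⟨ retraction-entry z j r ⟩
      entry z j r + δ j j₀ * - e * entry (⟦ D ⟧ z) zero r ≡⟨ cong (λ t → entry z j r + δ j j₀ * - e * t) (z∈Ker r) ⟩
      entry z j r + δ j j₀ * - e * 0#                     ≡⟨ cong (entry z j r +_) (zeroʳ _) ⟩
      entry z j r + 0#                                    ≡⟨ +-identityʳ _ ⟩
      entry z j r                                         ∎

  module Concatenation (k k' : ℕ) where
    left : Coeffs 𝔽 n (k ℕ.+ k') k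
    left = fromEntries (λ l i → δ l (i ↑ˡ k'))

    right : Coeffs 𝔽 n (k ℕ.+ k') k'
    right = fromEntries (λ l i → δ l (k ↑ʳ i))

    left-entry : (z : Vec Vⁿ (k ℕ.+ k')) (i : Fin k) (r : Fin n) → entry (⟦ left ⟧ z) i r ≡ entry z (i ↑ˡ k') r
    left-entry z i r = trans (applyM-fromEntries _ z i r) (sum-δ (i ↑ˡ k') (λ l → entry z l r))

    right-entry : (z : Vec Vⁿ (k ℕ.+ k')) (i : Fin k') (r : Fin n) → entry (⟦ right ⟧ z) i r ≡ entry z (k ↑ʳ i) r
    right-entry z i r = trans (applyM-fromEntries _ z i r) (sum-δ (k ↑ʳ i) (λ l → entry z l r))

    left-++ : (x : Vec Vⁿ k) (x' : Vec Vⁿ k') → ⟦ left ⟧ (x ++ x') ≡ x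
    left-++ x x' = entry-ext λ i r →
      trans (left-entry (x ++ x') i r) (cong (λ v → lookup v r) (lookup-++ˡ x x' i))

    right-++ : (x : Vec Vⁿ k) (x' : Vec Vⁿ k') → ⟦ right ⟧ (x ++ x') ≡ x'
    right-++ x x' = entry-ext λ i r →
      trans (right-entry (x ++ x') i r) (cong (λ v → lookup v r) (lookup-++ʳ x x' i))

    _⊖_ : Coeffs 𝔽 n k 1 → Coeffs 𝔽 n k' 1 → Coeffs 𝔽 n (k ℕ.+ k') 1
    τ ⊖ τ' = τ ++ Vec.map (Vec.map -_) τ'

    ⊖-entry : (τ : Coeffs 𝔽 n k 1) (τ' : Coeffs 𝔽 n k' 1) (z : Vec Vⁿ (k ℕ.+ k')) (r : Fin n) →
              entry (⟦ τ ⊖ τ' ⟧ z) zero r ≡ entry (⟦ τ ⟧ (⟦ left ⟧ z)) zero r + - entry (⟦ τ' ⟧ (⟦ right ⟧ z)) zero r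
    ⊖-entry τ τ' z r = begin
      entry (⟦ τ ⊖ τ' ⟧ z) zero r
        ≡⟨ applyM-entry (τ ⊖ τ') z zero r ⟩
      sum (λ l → entry (τ ⊖ τ') l zero * entry z l r)
        ≡⟨ sum-++ k (λ l → entry (τ ⊖ τ') l zero * entry z l r) ⟩
      sum (λ i → entry (τ ⊖ τ') (i ↑ˡ k') zero * entry z (i ↑ˡ k') r)
        + sum (λ i → entry (τ ⊖ τ') (k ↑ʳ i) zero * entry z (k ↑ʳ i) r)
        ≡⟨ cong₂ _+_ (sum-cong-≗ λ i → cong₂ _*_ (coeff-left i) (sym (left-entry z i r)))
                     (sum-cong-≗ λ i → trans (cong₂ _*_ (coeff-right i) (sym (right-entry z i r)))
                                             (sym (-‿distribˡ-* _ _))) ⟩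
      sum (λ i → entry τ i zero * entry (⟦ left ⟧ z) i r)
        + sum (λ i → - (entry τ' i zero * entry (⟦ right ⟧ z) i r))
        ≡⟨ cong₂ _+_ (sym (applyM-entry τ _ zero r))
                     (trans (sum-neg (λ i → entry τ' i zero * entry (⟦ right ⟧ z) i r))
                            (cong -_ (sym (applyM-entry τ' _ zero r)))) ⟩
      entry (⟦ τ ⟧ (⟦ left ⟧ z)) zero r + - entry (⟦ τ' ⟧ (⟦ right ⟧ z)) zero r
        ∎
      where
        coeff-left : (i : Fin k) → entry (τ ⊖ τ') (i ↑ˡ k') zero ≡ entry τ i zero
        coeff-left i = cong (λ row → lookup row zero) (lookup-++ˡ τ _ i)
        coeff-right : (i : Fin k') → entry (τ ⊖ τ') (k ↑ʳ i) zero ≡ - entry τ' i zero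
        coeff-right i = begin
          entry (τ ⊖ τ') (k ↑ʳ i) zero                     ≡⟨ cong (λ row → lookup row zero) (lookup-++ʳ τ _ i) ⟩
          lookup (lookup (Vec.map (Vec.map -_) τ') i) zero ≡⟨ cong (λ row → lookup row zero) (lookup-map i _ τ') ⟩
          lookup (Vec.map -_ (lookup τ' i)) zero            ≡⟨ lookup-map zero -_ (lookup τ' i) ⟩
          - entry τ' i zero                                 ∎

    ⊖-Ker-++ : (τ : Coeffs 𝔽 n k 1) (τ' : Coeffs 𝔽 n k' 1) (x : Vec Vⁿ k) (x' : Vec Vⁿ k') →
               ⟦ τ ⟧ x ≡ ⟦ τ' ⟧ x' → Ker (τ ⊖ τ') (x ++ x')
    ⊖-Ker-++ τ τ' x x' τx≡τ'x' r = begin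
      entry (⟦ τ ⊖ τ' ⟧ (x ++ x')) zero r
        ≡⟨ ⊖-entry τ τ' (x ++ x') r ⟩
      entry (⟦ τ ⟧ (⟦ left ⟧ (x ++ x'))) zero r + - entry (⟦ τ' ⟧ (⟦ right ⟧ (x ++ x'))) zero r
        ≡⟨ cong₂ (λ u u' → entry (⟦ τ ⟧ u) zero r + - entry (⟦ τ' ⟧ u') zero r) (left-++ x x') (right-++ x x') ⟩
      entry (⟦ τ ⟧ x) zero r + - entry (⟦ τ' ⟧ x') zero r
        ≡⟨ cong (λ v → entry (⟦ τ ⟧ x) zero r + - entry v zero r) (sym τx≡τ'x') ⟩
      entry (⟦ τ ⟧ x) zero r + - entry (⟦ τ ⟧ x) zero r
        ≡⟨ -‿inverseʳ _ ⟩
      0#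
        ∎

    Ker-⊖ : (τ : Coeffs 𝔽 n k 1) (τ' : Coeffs 𝔽 n k' 1) (z : Vec Vⁿ (k ℕ.+ k')) →
            Ker (τ ⊖ τ') z → ⟦ τ ⟧ (⟦ left ⟧ z) ≡ ⟦ τ' ⟧ (⟦ right ⟧ z)
    Ker-⊖ τ τ' z z∈Ker = entry-ext λ { zero r → x∙y⁻¹≈ε⇒x≈y _ _ (trans (sym (⊖-entry τ τ' z r)) (z∈Ker r)) }

module Unions (𝔽 : FiniteField) (n : ℕ) {S : Pred (V 𝔽 n) 0ℓ} (Π : (k : ℕ) → Partition 𝔽 n S k) where
  open Partition
  open LinearAlgebra 𝔽 n using (Vⁿ; ⟦_⟧; image?; ∃?-matrix)

  Piece : (k : ℕ) → Fin (size (Π k)) → Coeffs 𝔽 n k 1 → Pred Vⁿ 0ℓ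
  Piece k i c y = image 𝔽 n c (block (Π k) i) (y ∷ [])

  SamePiece : ℕ → Rel Vⁿ 0ℓ
  SamePiece k y z = ∃₂ λ i c → Piece k i c y × Piece k i c z

  SamePiece-sym : Symmetric (SamePiece k)
  SamePiece-sym (i , c , y∈ , z∈) = i , c , z∈ , y∈

  SameBlock₁ : Rel Vⁿ 0ℓ
  SameBlock₁ y z = ∃ λ j → (y ∷ []) ∈ᵇ block (Π 1) j × (z ∷ []) ∈ᵇ block (Π 1) j

  piece-point : (i : Fin (size (Π k))) (c : Coeffs 𝔽 n k 1) → ∃ (Piece k i c)
  piece-point {k} i c with nonempty (Π k) i
  ... | x , x∈ = head (⟦ c ⟧ x) , x , x∈ , vec1-η (⟦ c ⟧ x)

  block₁-point : (j : Fin (size (Π 1))) → ∃ λ y → (y ∷ []) ∈ᵇ block (Π 1) j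
  block₁-point j with nonempty (Π 1) j
  ... | x , x∈ = head x , subst (_∈ᵇ block (Π 1) j) (vec1-η x) x∈

  InUnionsS-decidable : {T : Pred Vⁿ 0ℓ} → InUnionsS 𝔽 n Π k T → Decidable T
  InUnionsS-decidable {k} (Q , T≐) y = map′ (proj₂ (T≐ y)) (proj₁ (T≐ y))
    (any? λ i → ∃?-matrix λ c → (Q (i , c) Bool.≟ true) ×-dec image? c (block (Π k) i) (y ∷ []))

  InUnionsS-respects : {T : Pred Vⁿ 0ℓ} {R : Rel Vⁿ 0ℓ} → InUnionsS 𝔽 n Π k T →
                       (∀ i c → Piece k i c Respects R) → T Respects R
  InUnionsS-respects (Q , T≐) piece-resp {y} {z} y~z Ty with proj₁ (T≐ y) Ty
  ... | i , c , q , y∈ = proj₂ (T≐ z) (i , c , q , piece-resp i c y~z y∈)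

  InUnionsS-∩-respecting : {T U : Pred Vⁿ 0ℓ} → InUnionsS 𝔽 n Π k T → Decidable U →
                           U Respects SamePiece k → InUnionsS 𝔽 n Π k (T ∩ U)
  InUnionsS-∩-respecting {k} {T} {U} (Q , T≐) U? U-resp = (λ p → does (kept? p)) , λ y → into y , outof y
    where
      point : ∀ i c → Vⁿ
      point i c = proj₁ (piece-point i c)

      kept? : ∀ p → Dec (p ∈ᵇ Q × U (point (proj₁ p) (proj₂ p)))
      kept? (i , c) = (Q (i , c) Bool.≟ true) ×-dec U? (point i c)

      into : ∀ y → (T ∩ U) y → ∃₂ λ i c → does (kept? (i , c)) ≡ true × Piece k i c y
      into y (Ty , Uy) with proj₁ (T≐ y) Ty
      ... | i , c , q , y∈ =
        i , c , dec-true (kept? (i , c)) (q , U-resp (i , c , y∈ , proj₂ (piece-point i c)) Uy) , y∈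

      outof : ∀ y → (∃₂ λ i c → does (kept? (i , c)) ≡ true × Piece k i c y) → (T ∩ U) y
      outof y (i , c , kept , y∈) with does⇒ (kept? (i , c)) kept
      ... | q , U-point = proj₂ (T≐ y) (i , c , q , y∈) , U-resp (i , c , proj₂ (piece-point i c) , y∈) U-point

  InUnionsΠ1-∩S-respecting : {U : Pred Vⁿ 0ℓ} → Decidable U → U Respects SameBlock₁ → InUnionsΠ1 𝔽 n Π (U ∩ S)
  InUnionsΠ1-∩S-respecting {U} U? U-resp = (λ j → does (U? (point j))) , λ y → into y , outof y
    where
      point : Fin (size (Π 1)) → Vⁿ
      point j = proj₁ (block₁-point j)

      into : ∀ y → (U ∩ S) y → ∃ λ j → does (U? (point j)) ≡ true × (y ∷ []) ∈ᵇ block (Π 1) j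
      into y (Uy , Sy) with covers (Π 1) (y ∷ []) (λ { zero → Sy })
      ... | j , y∈ = j , dec-true (U? (point j)) (U-resp (j , y∈ , proj₂ (block₁-point j)) Uy) , y∈

      outof : ∀ y → (∃ λ j → does (U? (point j)) ≡ true × (y ∷ []) ∈ᵇ block (Π 1) j) → (U ∩ S) y
      outof y (j , q , y∈) =
        U-resp (j , proj₂ (block₁-point j) , y∈) (does⇒ (U? (point j)) q) , ⊆S^k (Π 1) j (y ∷ []) y∈ zero

open import Data.Nat using (_+_)

module LinearScheme {𝔽 : FiniteField} {n m : ℕ} {S : Pred (V 𝔽 n) 0ℓ} {Π : (k : ℕ) → Partition 𝔽 n S k}
                    (scheme : IsLinearScheme 𝔽 n m S Π) where
  open Partition
  open FiniteField 𝔽 using (_≟_; 0#; inverse)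
  open LinearAlgebra 𝔽 n using (Vⁿ; ⟦_⟧; Ker; Ker-null; module Retraction; module Concatenation)
  open Unions 𝔽 n Π
  open ≡-Reasoning

  image-meets⇒≐ : 1 ≤ k → k ≤ m → 1 ≤ k' → k' ≤ m →
                  (i : Fin (size (Π k))) (i' : Fin (size (Π k'))) (c : Coeffs 𝔽 n k k') {x : Vec Vⁿ k} →
                  x ∈ᵇ block (Π k) i → ⟦ c ⟧ x ∈ᵇ block (Π k') i' →
                  image 𝔽 n c (block (Π k) i) ≐ (_∈ᵇ block (Π k') i')
  image-meets⇒≐ 1≤k k≤m 1≤k' k'≤m i i' c {x} x∈ cx∈ with IsLinearScheme.P1 scheme _ _ 1≤k k≤m 1≤k' k'≤m i i' c
  ... | inj₁ equal    = (λ {y} → proj₁ (equal y)) , (λ {y} → proj₂ (equal y))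
  ... | inj₂ disjoint = ⊥-elim (disjoint (⟦ c ⟧ x) (x , x∈ , refl) cx∈)

  Ker-fills-block : {K : ℕ} → 1 ≤ K → K ≤ m → (C : Fin (size (Π K))) (D : Coeffs 𝔽 n K 1) {w₀ w : Vec Vⁿ K} →
              w₀ ∈ᵇ block (Π K) C → Ker D w₀ → w ∈ᵇ block (Π K) C → Ker D w
  Ker-fills-block {K} 1≤K K≤m C D {w₀} {w} w₀∈C w₀∈Ker w∈C with all? (λ l → entry D l zero ≟ 0#)
  ... | yes D≡0 = Ker-null D D≡0 w
  ... | no D≢0 with ¬∀⟶∃¬ K _ (λ l → entry D l zero ≟ 0#) D≢0
  ... | j₀ , Dj₀≢0 with inverse (entry D j₀ zero) Dj₀≢0
  ... | e , inv with proj₂ (image-meets⇒≐ 1≤K K≤m 1≤K K≤m C C (Retraction.retraction D j₀ inv) w₀∈C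
                              (subst (_∈ᵇ block (Π K) C) (sym (Retraction.retraction-fixes-Ker D j₀ inv w₀ w₀∈Ker)) w₀∈C))
                      w∈C
  ... | v , _ , refl = Retraction.retraction-Ker D j₀ inv v

  ^-++ : {x : Vec Vⁿ k} {x' : Vec Vⁿ k'} →
         (_^_ 𝔽 n S k) x → (_^_ 𝔽 n S k') x' → (_^_ 𝔽 n S (k + k')) (x ++ x')
  ^-++ {k} {x = x} {x'} Sx Sx' l = subst S (sym (lookup-splitAt k x x' l))
    ([_,_] {C = λ s → S ([ lookup x , lookup x' ]′ s)} Sx Sx' (splitAt k l))

  image-meets-image⇒⊆ : 1 ≤ k → 1 ≤ k' → k + k' ≤ m →
                        (i : Fin (size (Π k))) (i' : Fin (size (Π k'))) (τ : Coeffs 𝔽 n k 1) (τ' : Coeffs 𝔽 n k' 1)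
                        {x : Vec Vⁿ k} {x' : Vec Vⁿ k'} → x ∈ᵇ block (Π k) i → x' ∈ᵇ block (Π k') i' →
                        ⟦ τ ⟧ x ≡ ⟦ τ' ⟧ x' → image 𝔽 n τ (block (Π k) i) ⊆ image 𝔽 n τ' (block (Π k') i')
  image-meets-image⇒⊆ {k} {k'} 1≤k 1≤k' K≤m i i' τ τ' {x} {x'} x∈ x'∈ τx≡τ'x' {y} (u , u∈ , τu≡y) =
    ⟦ right ⟧ w , right-into (w , w∈C , refl) , (begin
      ⟦ τ' ⟧ (⟦ right ⟧ w) ≡⟨ Ker-⊖ τ τ' w w∈Ker ⟨
      ⟦ τ ⟧ (⟦ left ⟧ w)   ≡⟨ cong ⟦ τ ⟧ left-w≡u ⟩
      ⟦ τ ⟧ u              ≡⟨ τu≡y ⟩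
      y                    ∎)
    where
      open Concatenation k k'
      1≤K : 1 ≤ k + k'
      1≤K = ≤-trans 1≤k (m≤m+n k k')
      x++x'∈S^K : (_^_ 𝔽 n S (k + k')) (x ++ x')
      x++x'∈S^K = ^-++ {x = x} {x'} (⊆S^k (Π k) i x x∈) (⊆S^k (Π k') i' x' x'∈)
      C : Fin (size (Π (k + k')))
      C = proj₁ (covers (Π (k + k')) (x ++ x') x++x'∈S^K)
      x++x'∈C : (x ++ x') ∈ᵇ block (Π (k + k')) C
      x++x'∈C = proj₂ (covers (Π (k + k')) (x ++ x') x++x'∈S^K)
      left-onto : (_∈ᵇ block (Π k) i) ⊆ image 𝔽 n left (block (Π (k + k')) C)
      left-onto = proj₂ (image-meets⇒≐ 1≤K K≤m 1≤k (≤-trans (m≤m+n k k') K≤m) C i left x++x'∈C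
                           (subst (_∈ᵇ block (Π k) i) (sym (left-++ x x')) x∈))
      right-into : image 𝔽 n right (block (Π (k + k')) C) ⊆ (_∈ᵇ block (Π k') i')
      right-into = proj₁ (image-meets⇒≐ 1≤K K≤m 1≤k' (≤-trans (m≤n+m k' k) K≤m) C i' right x++x'∈C
                            (subst (_∈ᵇ block (Π k') i') (sym (right-++ x x')) x'∈))
      w : Vec Vⁿ (k + k')
      w = proj₁ (left-onto u∈)
      w∈C : w ∈ᵇ block (Π (k + k')) C
      w∈C = proj₁ (proj₂ (left-onto u∈))
      left-w≡u : ⟦ left ⟧ w ≡ u
      left-w≡u = proj₂ (proj₂ (left-onto u∈))
      w∈Ker : Ker (τ ⊖ τ') w
      w∈Ker = Ker-fills-block 1≤K K≤m C (τ ⊖ τ') x++x'∈C (⊖-Ker-++ τ τ' x x' τx≡τ'x') w∈C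

  piece-respects-SameBlock₁ : 1 ≤ k → k ≤ m → (i : Fin (size (Π k))) (c : Coeffs 𝔽 n k 1) →
                              Piece k i c Respects SameBlock₁
  piece-respects-SameBlock₁ 1≤k k≤m i c (j , y∈ , z∈) (x , x∈ , cx≡y) =
    proj₂ (image-meets⇒≐ 1≤k k≤m ≤-refl (≤-trans 1≤k k≤m) i j c x∈ (subst (_∈ᵇ block (Π 1) j) (sym cx≡y) y∈)) z∈

  piece-respects-SamePiece : 1 ≤ k → 1 ≤ k' → k + k' ≤ m → (i' : Fin (size (Π k'))) (c' : Coeffs 𝔽 n k' 1) →
                             Piece k' i' c' Respects SamePiece k
  piece-respects-SamePiece 1≤k 1≤k' K≤m i' c' (i , c , (x , x∈ , cx≡y) , z∈) (x' , x'∈ , c'x'≡y) =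
    image-meets-image⇒⊆ 1≤k 1≤k' K≤m i i' c c' x∈ x'∈ (trans cx≡y (sym c'x'≡y)) z∈

  InUnionsS-∩S : {T : Pred Vⁿ 0ℓ} → 1 ≤ k → k ≤ m → InUnionsS 𝔽 n Π k T → InUnionsΠ1 𝔽 n Π (T ∩ S)
  InUnionsS-∩S 1≤k k≤m T∈ =
    InUnionsΠ1-∩S-respecting (InUnionsS-decidable T∈) (InUnionsS-respects T∈ (piece-respects-SameBlock₁ 1≤k k≤m))

  InUnionsS-respects-SamePiece : {T' : Pred Vⁿ 0ℓ} → 1 ≤ k → 1 ≤ k' → k + k' ≤ m →
                                 InUnionsS 𝔽 n Π k' T' → T' Respects SamePiece k
  InUnionsS-respects-SamePiece 1≤k 1≤k' K≤m T'∈ = InUnionsS-respects T'∈ (piece-respects-SamePiece 1≤k 1≤k' K≤m)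

  InUnionsS-∩ : {T T' : Pred Vⁿ 0ℓ} → 1 ≤ k → 1 ≤ k' → k + k' ≤ m →
                InUnionsS 𝔽 n Π k T → InUnionsS 𝔽 n Π k' T' → InUnionsS 𝔽 n Π k (T ∩ T')
  InUnionsS-∩ 1≤k 1≤k' K≤m T∈ T'∈ =
    InUnionsS-∩-respecting T∈ (InUnionsS-decidable T'∈) (InUnionsS-respects-SamePiece 1≤k 1≤k' K≤m T'∈)

  InUnionsS-∖ : {T T' : Pred Vⁿ 0ℓ} → 1 ≤ k → 1 ≤ k' → k + k' ≤ m →
                InUnionsS 𝔽 n Π k T → InUnionsS 𝔽 n Π k' T' → InUnionsS 𝔽 n Π k (T ∖ T')
  InUnionsS-∖ {k = k} 1≤k 1≤k' K≤m T∈ T'∈ =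
    InUnionsS-∩-respecting T∈ (λ y → ¬? (InUnionsS-decidable T'∈ y))
      (∁-respects {R = SamePiece k} SamePiece-sym (InUnionsS-respects-SamePiece 1≤k 1≤k' K≤m T'∈))

lemmaD4 : (𝔽 : FiniteField) (n m : ℕ) (S : Pred (V 𝔽 n) 0ℓ)
          (Π : (k : ℕ) → Partition 𝔽 n S k) → IsLinearScheme 𝔽 n m S Π →
          ((k : ℕ) → 1 ≤ k → k ≤ m → (T : Pred (V 𝔽 n) 0ℓ) →
            InUnionsS 𝔽 n Π k T → InUnionsΠ1 𝔽 n Π (T ∩ S))
          ×
          ((k k' : ℕ) → 1 ≤ k → 1 ≤ k' → k + k' ≤ m → (T T' : Pred (V 𝔽 n) 0ℓ) →
            InUnionsS 𝔽 n Π k T → InUnionsS 𝔽 n Π k' T' →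
            InUnionsS 𝔽 n Π k (T ∩ T') × InUnionsS 𝔽 n Π k (T ∖ T'))
lemmaD4 𝔽 n m S Π scheme =
  (λ k 1≤k k≤m T → InUnionsS-∩S 1≤k k≤m) ,
  (λ k k' 1≤k 1≤k' K≤m T T' T∈ T'∈ → InUnionsS-∩ 1≤k 1≤k' K≤m T∈ T'∈ , InUnionsS-∖ 1≤k 1≤k' K≤m T∈ T'∈)
  where
    open LinearScheme scheme
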